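{- A graph $G$ is uniquely determined by its vertex set $V$ and its pivotal poset $\mathcal{R}_0(G)$: if $G$ and $G'$ are graphs on the same vertex set $V$ with $\mathcal{R}_0(G)=\mathcal{R}_0(G')$, then $G=G'$.
   Context: A graph is a finite graph with vertex set $V$, no multiple edges, in which each vertex may or may not carry a loop. Its adjacency matrix $A$ is the symmetric $V\times V$ matrix over $\mathbf{F}_2$ with $A_{vw}=1$ iff $v\ne w$ are adjacent and $A_{vv}=1$ iff $v$ has a loop. Let $\mathcal{V}$ be the $\mathbf{F}_2$-vector space with basis $V$, $\mathcal{E}(x,y)=x^TAy$, and for $W\subseteq V$ let $\langle W\rangle^{\perp}=\{x:\mathcal{E}(x,w)=0\ \forall w\in\langle W\rangle\}$. $W$ is reducible if $\langle W\rangle+\langle W\rangle^{\perp}=\mathcal{V}$; its nullity is $|W|-\mathrm{rank}(A_{W,W})$ ($\mathbf{F}_2$-rank of the principal submatrix on $W$). The pivotal poset $\mathcal{R}_0(G)$ is the set of subsets $W\subseteq V$ that are reducible and have nullity $0$; equivalently, the set of $W\subseteq V$ for which $A_{W,W}$ is invertible over $\mathbf{F}_2$ (with $\emptyset\in\mathcal{R}_0(G)$). -}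

module Defs where

open import Data.Nat using (ℕ; zero; suc)
open import Data.Bool using (Bool; true; false; _xor_; _∧_; if_then_else_)
open import Data.Fin using (Fin; zero; suc; _≟_)
open import Data.Fin.Subset using (Subset; _∈_)
open import Data.Vec using (_∷_; [])
open import Data.Product using (Σ; _×_)
open import Relation.Binary.PropositionalEquality using (_≡_)
open import Relation.Nullary using (does)

-- Vertex set V = Fin n.  Scalars in F₂ are Bool (addition = xor, multiplication = ∧).

-- A graph on Fin n (no multiple edges, loops allowed): a symmetric F₂-adjacency matrix.
-- adj v w = true iff v ≠ w are adjacent, adj v v = true iff v carries a loop.
record Graph (n : ℕ) : Set where
  field
    adj : Fin n → Fin n → Bool
    sym : ∀ v w → adj v w ≡ adj w v
open Graph public

sumOver : ∀ {n} → Subset n → (Fin n → Bool) → Bool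
sumOver {zero}  []            f = false
sumOver {suc n} (true  ∷ W)   f = f zero xor sumOver W (λ i → f (suc i))
sumOver {suc n} (false ∷ W)   f = sumOver W (λ i → f (suc i))

δ : ∀ {n} → Fin n → Fin n → Bool
δ i j = does (i ≟ j)

-- The principal submatrix M_{W,W} is invertible over F₂: there is a W×W matrix B
-- (given as a Fin n × Fin n matrix, only its W×W entries matter) with
-- M_{W,W} B = I and B M_{W,W} = I.
InvertibleOn : ∀ {n} → (Fin n → Fin n → Bool) → Subset n → Set
InvertibleOn {n} M W =
  Σ (Fin n → Fin n → Bool) λ B →
    (∀ i j → i ∈ W → j ∈ W → sumOver W (λ k → M i k ∧ B k j) ≡ δ i j)
  × (∀ i j → i ∈ W → j ∈ W → sumOver W (λ k → B i k ∧ M k j) ≡ δ i j)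

-- The pivotal poset R₀(G), as a predicate on subsets W ⊆ V:
-- W ∈ R₀(G) iff A_{W,W} is invertible over F₂ (∅ is included, the empty matrix being invertible).
R₀ : ∀ {n} → Graph n → Subset n → Set
R₀ G W = InvertibleOn (adj G) W

module Submission where

-- Whether a subset W lies in R₀(G) depends only on the principal submatrix
-- A_{W,W}, so the subsets of size one and two already pin down A:
--   * a 1×1 matrix (a) is invertible over F₂ iff a = 1, so {v} ∈ R₀(G)
--     iff v carries a loop: R₀(G) determines the diagonal of A;
--   * a 2×2 matrix over F₂ is invertible iff its determinant is 1 (one
--     direction by multiplicativity of det₂, the other by the adjugate), and
--     for the symmetric matrix [[a, b], [b, c]] the determinant is ac + b,
--     since b² = b in F₂.  So {v, w} ∈ R₀(G) determines ac + b, and, the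
--     diagonal being known, the off-diagonal entry b.

open import Defs renaming (sym to adj-symmetric)
open import Data.Nat using (ℕ; zero; suc)
open import Data.Fin using (Fin; zero; suc; _≟_)
open import Data.Fin.Subset using (Subset; ⁅_⁆; _∪_; ⊥; _∈_)
open import Data.Fin.Subset.Properties
  using (x∈⁅x⁆; x∈⁅y⁆⇒x≡y; x∈p∪q⁻; x∈p∪q⁺; ∪-identityˡ; ∪-identityʳ)
open import Data.Bool using (Bool; true; false; _xor_; _∧_; if_then_else_)
open import Data.Bool.Properties
  using (xor-comm; xor-same; ∧-comm; ∧-idem; ∧-identityʳ; not-injective; xor-∧-commutativeRing)
open import Data.Maybe using (Maybe; just; nothing)
open import Data.Product using (Σ; _×_; _,_)
open import Data.Sum using (_⊎_; inj₁; inj₂)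
open import Function.Bundles using (_⇔_; mk⇔; Equivalence)
open import Function.Construct.Composition using (_⇔-∘_)
open import Relation.Binary.PropositionalEquality
  using (_≡_; _≢_; refl; sym; trans; cong; cong₂; subst₂; module ≡-Reasoning)
open import Relation.Nullary using (yes; no; does)
open import Relation.Nullary.Decidable using (dec-true; dec-false)
open import Tactic.RingSolver using (solve-∀)
open import Tactic.RingSolver.Core.AlmostCommutativeRing
  using (AlmostCommutativeRing; fromCommutativeRing)

open ≡-Reasoning

private
  variable
    n : ℕ

≡true-injective : ∀ {x y : Bool} → (x ≡ true ⇔ y ≡ true) → x ≡ y
≡true-injective {false} {false} x⇔y = refl
≡true-injective {false} {true}  x⇔y = Equivalence.from x⇔y refl
≡true-injective {true}  {false} x⇔y = sym (Equivalence.to x⇔y refl)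
≡true-injective {true}  {true}  x⇔y = refl

-- A boolean characterising P for G and Q for G′ is the same for both as soon
-- as P ⇔ Q; this is how R₀(G) = R₀(G′) is turned into equalities of entries.
agree-via : ∀ {x y : Bool} {P Q : Set} →
  (x ≡ true ⇔ P) → (y ≡ true ⇔ Q) → (P ⇔ Q) → x ≡ y
agree-via x⇔P y⇔Q P⇔Q = ≡true-injective (mk⇔
  (λ x≡1 → Equivalence.from y⇔Q (Equivalence.to P⇔Q (Equivalence.to x⇔P x≡1)))
  (λ y≡1 → Equivalence.from x⇔P (Equivalence.from P⇔Q (Equivalence.to y⇔Q y≡1))))

xor-cancelˡ : ∀ x {y z} → x xor y ≡ x xor z → y ≡ z
xor-cancelˡ true  = not-injective
xor-cancelˡ false = λ y≡z → y≡z

∧-true⇒trueˡ : ∀ {x y} → x ∧ y ≡ true → x ≡ true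
∧-true⇒trueˡ {true} _ = refl

∧-swap-cancels : ∀ x y → (x ∧ y) xor (y ∧ x) ≡ false
∧-swap-cancels x y = trans (cong ((x ∧ y) xor_) (∧-comm y x)) (xor-same (x ∧ y))

δ-refl : (v : Fin n) → δ v v ≡ true
δ-refl v = dec-true (v ≟ v) refl

δ-≢ : {v w : Fin n} → v ≢ w → δ v w ≡ false
δ-≢ {v = v} {w} v≢w = dec-false (v ≟ w) v≢w

sumOver-⊥ : (f : Fin n → Bool) → sumOver ⊥ f ≡ false
sumOver-⊥ {zero}  f = refl
sumOver-⊥ {suc n} f = sumOver-⊥ (λ i → f (suc i))

sumOver-⁅⁆ : (v : Fin n) (f : Fin n → Bool) → sumOver ⁅ v ⁆ f ≡ f v
sumOver-⁅⁆ zero    f =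
  trans (cong (f zero xor_) (sumOver-⊥ (λ i → f (suc i)))) (xor-comm (f zero) false)
sumOver-⁅⁆ (suc v) f = sumOver-⁅⁆ v (λ i → f (suc i))

pair : Fin n → Fin n → Subset n
pair v w = ⁅ v ⁆ ∪ ⁅ w ⁆

sumOver-pair : {v w : Fin n} → v ≢ w → (f : Fin n → Bool) →
  sumOver (pair v w) f ≡ f v xor f w
sumOver-pair {v = zero}  {zero}  v≢w f with () ← v≢w refl
sumOver-pair {v = zero}  {suc w} v≢w f = cong (f zero xor_) (begin
  sumOver (⊥ ∪ ⁅ w ⁆) (λ i → f (suc i))
    ≡⟨ cong (λ p → sumOver p (λ i → f (suc i))) (∪-identityˡ ⁅ w ⁆) ⟩
  sumOver ⁅ w ⁆ (λ i → f (suc i))       ≡⟨ sumOver-⁅⁆ w (λ i → f (suc i)) ⟩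
  f (suc w)                             ∎)
sumOver-pair {v = suc v} {zero}  v≢w f = begin
  f zero xor sumOver (⁅ v ⁆ ∪ ⊥) (λ i → f (suc i))
    ≡⟨ cong (λ p → f zero xor sumOver p (λ i → f (suc i))) (∪-identityʳ ⁅ v ⁆) ⟩
  f zero xor sumOver ⁅ v ⁆ (λ i → f (suc i))       ≡⟨ cong (f zero xor_) (sumOver-⁅⁆ v (λ i → f (suc i))) ⟩
  f zero xor f (suc v)                             ≡⟨ xor-comm (f zero) (f (suc v)) ⟩
  f (suc v) xor f zero                             ∎
sumOver-pair {v = suc v} {suc w} v≢w f = sumOver-pair (λ v≡w → v≢w (cong suc v≡w)) (λ i → f (suc i))

∈-pair⁻ : {i v w : Fin n} → i ∈ pair v w → i ≡ v ⊎ i ≡ w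
∈-pair⁻ {v = v} {w} i∈ with x∈p∪q⁻ ⁅ v ⁆ ⁅ w ⁆ i∈
... | inj₁ i∈⁅v⁆ = inj₁ (x∈⁅y⁆⇒x≡y v i∈⁅v⁆)
... | inj₂ i∈⁅w⁆ = inj₂ (x∈⁅y⁆⇒x≡y w i∈⁅w⁆)

invertible-⁅⁆⇔ : (M : Fin n → Fin n → Bool) (v : Fin n) →
  M v v ≡ true ⇔ InvertibleOn M ⁅ v ⁆
invertible-⁅⁆⇔ M v = mk⇔ inverse-of-1 unit
  where
  unit : InvertibleOn M ⁅ v ⁆ → M v v ≡ true
  unit (B , MB≡I , _) = ∧-true⇒trueˡ (begin
    M v v ∧ B v v                        ≡⟨ sym (sumOver-⁅⁆ v (λ k → M v k ∧ B k v)) ⟩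
    sumOver ⁅ v ⁆ (λ k → M v k ∧ B k v) ≡⟨ MB≡I v v (x∈⁅x⁆ v) (x∈⁅x⁆ v) ⟩
    δ v v                                ≡⟨ δ-refl v ⟩
    true                                 ∎)

  inverse-of-1 : M v v ≡ true → InvertibleOn M ⁅ v ⁆
  inverse-of-1 Mvv≡1 = (λ _ _ → true) , right , left
    where
    right : ∀ i j → i ∈ ⁅ v ⁆ → j ∈ ⁅ v ⁆ → sumOver ⁅ v ⁆ (λ k → M i k ∧ true) ≡ δ i j
    right i j i∈ j∈ with refl ← x∈⁅y⁆⇒x≡y v i∈ | refl ← x∈⁅y⁆⇒x≡y v j∈ = begin
      sumOver ⁅ v ⁆ (λ k → M v k ∧ true) ≡⟨ sumOver-⁅⁆ v (λ k → M v k ∧ true) ⟩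
      M v v ∧ true                        ≡⟨ ∧-identityʳ (M v v) ⟩
      M v v                               ≡⟨ trans Mvv≡1 (sym (δ-refl v)) ⟩
      δ v v                               ∎
    left : ∀ i j → i ∈ ⁅ v ⁆ → j ∈ ⁅ v ⁆ → sumOver ⁅ v ⁆ (λ k → true ∧ M k j) ≡ δ i j
    left i j i∈ j∈ with refl ← x∈⁅y⁆⇒x≡y v i∈ | refl ← x∈⁅y⁆⇒x≡y v j∈ =
      trans (sumOver-⁅⁆ v (λ k → M k v)) (trans Mvv≡1 (sym (δ-refl v)))

F₂ : AlmostCommutativeRing _ _
F₂ = fromCommutativeRing xor-∧-commutativeRing is-zero
  where
  is-zero : (x : Bool) → Maybe (false ≡ x)
  is-zero false = just refl
  is-zero true  = nothing

Mat₂ : Set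
Mat₂ = Fin 2 → Fin 2 → Bool

pattern one = suc zero

infixl 7 _·₂_
_·₂_ : Mat₂ → Mat₂ → Mat₂
(N ·₂ B) i j = (N i zero ∧ B zero j) xor (N i one ∧ B one j)

det₂ : Mat₂ → Bool
det₂ N = (N zero zero ∧ N one one) xor (N zero one ∧ N one zero)

-- The adjugate; over F₂ no signs are needed.
adj₂ : Mat₂ → Mat₂
adj₂ N zero zero = N one one
adj₂ N zero one  = N zero one
adj₂ N one  zero = N one zero
adj₂ N one  one  = N zero zero

Invertible₂ : Mat₂ → Set
Invertible₂ N = Σ Mat₂ λ B → (∀ i j → (N ·₂ B) i j ≡ δ i j) × (∀ i j → (B ·₂ N) i j ≡ δ i j)

det₂-· : ∀ N B → det₂ (N ·₂ B) ≡ det₂ N ∧ det₂ B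
det₂-· N B = multiplicative (N zero zero) (N zero one) (N one zero) (N one one)
                            (B zero zero) (B zero one) (B one zero) (B one one)
  where
  multiplicative : ∀ a b c d p q r s →
    (((a ∧ p) xor (b ∧ r)) ∧ ((c ∧ q) xor (d ∧ s))) xor (((a ∧ q) xor (b ∧ s)) ∧ ((c ∧ p) xor (d ∧ r)))
    ≡ ((a ∧ d) xor (b ∧ c)) ∧ ((p ∧ s) xor (q ∧ r))
  multiplicative = solve-∀ F₂

det₂-cong : ∀ {N N′} → (∀ i j → N i j ≡ N′ i j) → det₂ N ≡ det₂ N′
det₂-cong N≡N′ = cong₂ _xor_ (cong₂ _∧_ (N≡N′ zero zero) (N≡N′ one one))
                             (cong₂ _∧_ (N≡N′ zero one) (N≡N′ one zero))

-- A matrix with a right inverse has determinant 1: det N · det B = det I = 1.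
invertible₂⇒det : ∀ N → Invertible₂ N → det₂ N ≡ true
invertible₂⇒det N (B , NB≡I , _) = ∧-true⇒trueˡ (trans (sym (det₂-· N B)) (det₂-cong NB≡I))

det⇒invertible₂ : ∀ N → det₂ N ≡ true → Invertible₂ N
det⇒invertible₂ N det≡1 = adj₂ N , right , left
  where
  a = N zero zero; b = N zero one; c = N one zero; d = N one one

  right : ∀ i j → (N ·₂ adj₂ N) i j ≡ δ i j
  right zero zero = det≡1
  right zero one  = ∧-swap-cancels a b
  right one  zero = ∧-swap-cancels c d
  right one  one  = begin
    (c ∧ b) xor (d ∧ a) ≡⟨ xor-comm (c ∧ b) (d ∧ a) ⟩
    (d ∧ a) xor (c ∧ b) ≡⟨ cong₂ _xor_ (∧-comm d a) (∧-comm c b) ⟩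
    (a ∧ d) xor (b ∧ c) ≡⟨ det≡1 ⟩
    true                ∎

  left : ∀ i j → (adj₂ N ·₂ N) i j ≡ δ i j
  left zero zero = trans (cong (_xor (b ∧ c)) (∧-comm d a)) det≡1
  left zero one  = ∧-swap-cancels d b
  left one  zero = ∧-swap-cancels c a
  left one  one  = begin
    (c ∧ b) xor (a ∧ d) ≡⟨ xor-comm (c ∧ b) (a ∧ d) ⟩
    (a ∧ d) xor (c ∧ b) ≡⟨ cong ((a ∧ d) xor_) (∧-comm c b) ⟩
    (a ∧ d) xor (b ∧ c) ≡⟨ det≡1 ⟩
    true                ∎

invertible₂⇔det : ∀ N → det₂ N ≡ true ⇔ Invertible₂ N
invertible₂⇔det N = mk⇔ (det⇒invertible₂ N) (invertible₂⇒det N)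

·₂-cong : ∀ {N N′ B B′} → (∀ i j → N i j ≡ N′ i j) → (∀ i j → B i j ≡ B′ i j) →
  ∀ i j → (N ·₂ B) i j ≡ (N′ ·₂ B′) i j
·₂-cong N≡N′ B≡B′ i j =
  cong₂ _xor_ (cong₂ _∧_ (N≡N′ i zero) (B≡B′ zero j)) (cong₂ _∧_ (N≡N′ i one) (B≡B′ one j))

module OnPair {n : ℕ} {v w : Fin n} (v≢w : v ≢ w) where

  at : Fin 2 → Fin n
  at zero = v
  at one  = w

  index : Fin n → Fin 2
  index k = if does (k ≟ v) then zero else one

  restrict : (Fin n → Fin n → Bool) → Mat₂
  restrict M i j = M (at i) (at j)

  extend : Mat₂ → Fin n → Fin n → Bool
  extend B k l = B (index k) (index l)

  at-∈ : ∀ i → at i ∈ pair v w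
  at-∈ zero = x∈p∪q⁺ (inj₁ (x∈⁅x⁆ v))
  at-∈ one  = x∈p∪q⁺ {p = ⁅ v ⁆} (inj₂ (x∈⁅x⁆ w))

  index-at : ∀ i → index (at i) ≡ i
  index-at zero rewrite dec-true (v ≟ v) refl = refl
  index-at one  rewrite dec-false (w ≟ v) (λ w≡v → v≢w (sym w≡v)) = refl

  at-index : ∀ {k} → k ∈ pair v w → at (index k) ≡ k
  at-index k∈ with ∈-pair⁻ k∈
  ... | inj₁ refl = cong at (index-at zero)
  ... | inj₂ refl = cong at (index-at one)

  δ-at : ∀ i j → δ (at i) (at j) ≡ δ i j
  δ-at zero zero = δ-refl v
  δ-at zero one  = δ-≢ v≢w
  δ-at one  zero = δ-≢ (λ w≡v → v≢w (sym w≡v))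
  δ-at one  one  = δ-refl w

  restrict-extend : ∀ B i j → restrict (extend B) i j ≡ B i j
  restrict-extend B i j = cong₂ B (index-at i) (index-at j)

  on-pair : (P : Fin n → Fin n → Set) → (∀ i j → P (at i) (at j)) →
    ∀ k l → k ∈ pair v w → l ∈ pair v w → P k l
  on-pair P P-at k l k∈ l∈ = subst₂ P (at-index k∈) (at-index l∈) (P-at (index k) (index l))

  sumOver-pair-· : ∀ M B i j →
    sumOver (pair v w) (λ k → M (at i) k ∧ B k (at j)) ≡ (restrict M ·₂ restrict B) i j
  sumOver-pair-· M B i j = sumOver-pair v≢w (λ k → M (at i) k ∧ B k (at j))

  invertible₂⇔invertibleOn : ∀ M → Invertible₂ (restrict M) ⇔ InvertibleOn M (pair v w)
  invertible₂⇔invertibleOn M = mk⇔ extend-inverse restrict-inverse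
    where
    restrict-inverse : InvertibleOn M (pair v w) → Invertible₂ (restrict M)
    restrict-inverse (B , MB≡I , BM≡I) = restrict B , right , left
      where
      right : ∀ i j → (restrict M ·₂ restrict B) i j ≡ δ i j
      right i j = trans (sym (sumOver-pair-· M B i j))
                        (trans (MB≡I (at i) (at j) (at-∈ i) (at-∈ j)) (δ-at i j))
      left : ∀ i j → (restrict B ·₂ restrict M) i j ≡ δ i j
      left i j = trans (sym (sumOver-pair-· B M i j))
                       (trans (BM≡I (at i) (at j) (at-∈ i) (at-∈ j)) (δ-at i j))

    extend-inverse : Invertible₂ (restrict M) → InvertibleOn M (pair v w)
    extend-inverse (B , MB≡I , BM≡I) = extend B , on-pair _ right , on-pair _ left
      where
      right : ∀ i j → sumOver (pair v w) (λ k → M (at i) k ∧ extend B k (at j)) ≡ δ (at i) (at j)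
      right i j = begin
        sumOver (pair v w) (λ k → M (at i) k ∧ extend B k (at j))
          ≡⟨ sumOver-pair-· M (extend B) i j ⟩
        (restrict M ·₂ restrict (extend B)) i j
          ≡⟨ ·₂-cong {N = restrict M} (λ _ _ → refl) (restrict-extend B) i j ⟩
        (restrict M ·₂ B) i j                  ≡⟨ MB≡I i j ⟩
        δ i j                                  ≡⟨ sym (δ-at i j) ⟩
        δ (at i) (at j)                        ∎
      left : ∀ i j → sumOver (pair v w) (λ k → extend B (at i) k ∧ M k (at j)) ≡ δ (at i) (at j)
      left i j = begin
        sumOver (pair v w) (λ k → extend B (at i) k ∧ M k (at j))
          ≡⟨ sumOver-pair-· (extend B) M i j ⟩
        (restrict (extend B) ·₂ restrict M) i j
          ≡⟨ ·₂-cong {B = restrict M} (restrict-extend B) (λ _ _ → refl) i j ⟩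
        (B ·₂ restrict M) i j                  ≡⟨ BM≡I i j ⟩
        δ i j                                  ≡⟨ sym (δ-at i j) ⟩
        δ (at i) (at j)                        ∎

  det₂⇔invertibleOn : ∀ M → det₂ (restrict M) ≡ true ⇔ InvertibleOn M (pair v w)
  det₂⇔invertibleOn M = invertible₂⇔invertibleOn M ⇔-∘ invertible₂⇔det (restrict M)

  det₂-adj : (G : Graph n) → det₂ (restrict (adj G)) ≡ (adj G v v ∧ adj G w w) xor adj G v w
  det₂-adj G = cong ((adj G v v ∧ adj G w w) xor_) (begin
    adj G v w ∧ adj G w v ≡⟨ cong (adj G v w ∧_) (adj-symmetric G w v) ⟩
    adj G v w ∧ adj G v w ≡⟨ ∧-idem (adj G v w) ⟩
    adj G v w             ∎)

loops-agree : (G G′ : Graph n) → (∀ W → R₀ G W ⇔ R₀ G′ W) → ∀ v → adj G v v ≡ adj G′ v v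
loops-agree G G′ same v =
  agree-via (invertible-⁅⁆⇔ (adj G) v) (invertible-⁅⁆⇔ (adj G′) v) (same ⁅ v ⁆)

-- The pivotal poset determines the diagonal through singletons, and then each
-- off-diagonal entry A_vw through the determinant A_vv A_ww + A_vw of {v, w}.
mainTheorem8 : ∀ (n : ℕ) (G G′ : Graph n) →
    (∀ (W : Subset n) → R₀ G W ⇔ R₀ G′ W) →
    ∀ (v w : Fin n) → adj G v w ≡ adj G′ v w
mainTheorem8 n G G′ same v w with v ≟ w
... | yes refl = loops-agree G G′ same v
... | no v≢w = xor-cancelˡ (adj G v v ∧ adj G w w) (begin
  (adj G v v ∧ adj G w w) xor adj G v w    ≡⟨ sym (det₂-adj G) ⟩
  det₂ (restrict (adj G))                  ≡⟨ agree-via (det₂⇔invertibleOn (adj G))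
                                                        (det₂⇔invertibleOn (adj G′)) (same (pair v w)) ⟩
  det₂ (restrict (adj G′))                 ≡⟨ det₂-adj G′ ⟩
  (adj G′ v v ∧ adj G′ w w) xor adj G′ v w ≡⟨ cong (_xor adj G′ v w) (sym (cong₂ _∧_ (loops v) (loops w))) ⟩
  (adj G v v ∧ adj G w w) xor adj G′ v w   ∎)
  where
  open OnPair v≢w
  loops : ∀ u → adj G u u ≡ adj G′ u u
  loops = loops-agree G G′ same
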